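{- Let $K$ be a nonzero integer, let $N\ge 0$ be an integer, and let $S=\{\gamma_1,\dots,\gamma_n\}\subset\mathbb{R}$. Suppose $S$ is weakly $N$-dependent, i.e. there exist integers $\alpha_1,\dots,\alpha_n$, not all zero, with $\alpha_1\gamma_1+\cdots+\alpha_n\gamma_n=0$, $|\alpha_i|\le N+1$ for all $i$, and $|\alpha_i|=N+1$ for at most one index $i$. Then there exists a nonzero vector $v\in L(K;S)$ with \[ |v|^2 < (n^2+n)N^2+(2n+2)N+2 . \]
   Context: For $\gamma\in\mathbb{R}$ define $\gamma'$ by $K\gamma'=\lfloor K\gamma\rfloor$. For $S=\{\gamma_1,\dots,\gamma_n\}$, $L(K;S)\subset\mathbb{Z}^{n+1}$ is the lattice generated by the $n$ vectors $e_i + K\gamma_i'\,e_{n+1}$ ($i=1,\dots,n$), where $e_1,\dots,e_{n+1}$ are the standard basis vectors of $\mathbb{Z}^{n+1}$; i.e. its elements are $(a_1,\dots,a_n,\,K(a_1\gamma_1'+\cdots+a_n\gamma_n'))$ with $a_i\in\mathbb{Z}$. $|v|$ denotes the Euclidean norm. -}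

module Defs where

open import Level using (0ℓ)
open import Data.Nat as ℕ using (ℕ; zero; suc)
open import Data.Integer as ℤ using (ℤ; +_; -[1+_]; ∣_∣)
open import Data.Fin using (Fin)
open import Data.Product using (Σ; ∃; _×_; _,_)
open import Data.Vec.Functional using (Vector; _++_)
open import Relation.Nullary using (¬_)
open import Relation.Binary.PropositionalEquality using (_≡_)
open import Relation.Binary.Core using (Rel)
open import Relation.Binary.Structures using (IsTotalOrder)
open import Algebra.Core using (Op₁; Op₂)
open import Algebra.Structures using (IsCommutativeRing)
open import Function.Definitions using (Injective)

embℕ : {A : Set} → Op₂ A → A → A → ℕ → A
embℕ _+_ 0# 1# zero    = 0#
embℕ _+_ 0# 1# (suc n) = 1# + embℕ _+_ 0# 1# n

embℤ : {A : Set} → Op₂ A → Op₁ A → A → A → ℤ → A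
embℤ _+_ -_ 0# 1# (+ n)    = embℕ _+_ 0# 1# n
embℤ _+_ -_ 0# 1# -[1+ n ] = - embℕ _+_ 0# 1# (suc n)

-- An axiomatisation of the real numbers: a complete (least upper bound
-- property) totally ordered field.  Any such structure is isomorphic to ℝ,
-- so quantifying over all of them is the faithful rendering of "γ ∈ ℝ".
-- The floor function (which exists in ℝ) is supplied as part of the data,
-- together with its defining specification.
record RealField : Set₁ where
  infixl 6 _+_
  infixl 7 _*_
  infix 4 _≤_
  field
    Carrier : Set
    _+_ _*_ : Op₂ Carrier
    -_      : Op₁ Carrier
    0# 1#   : Carrier
    isCommutativeRing : IsCommutativeRing _≡_ _+_ _*_ -_ 0# 1#
    0≢1     : ¬ (0# ≡ 1#)
    inverse : ∀ x → ¬ (x ≡ 0#) → Σ Carrier (λ y → x * y ≡ 1#)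
    _≤_     : Rel Carrier 0ℓ
    isTotalOrder : IsTotalOrder _≡_ _≤_
    +-monoˡ-≤ : ∀ {x y} z → x ≤ y → x + z ≤ y + z
    *-nonneg  : ∀ {x y} → 0# ≤ x → 0# ≤ y → 0# ≤ x * y
    complete : (P : Carrier → Set) → ∃ P → ∃ (λ b → ∀ x → P x → x ≤ b) →
               Σ Carrier (λ s → (∀ x → P x → x ≤ s)
                              × (∀ b → (∀ x → P x → x ≤ b) → s ≤ b))
    ⌊_⌋      : Carrier → ℤ
    ⌊⌋-lower : ∀ x → embℤ _+_ -_ 0# 1# ⌊ x ⌋ ≤ x
    ⌊⌋-upper : ∀ x → (x ≤ embℤ _+_ -_ 0# 1# ⌊ x ⌋ + 1#)
                   × ¬ (x ≡ embℤ _+_ -_ 0# 1# ⌊ x ⌋ + 1#)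

  fromℤ : ℤ → Carrier
  fromℤ = embℤ _+_ -_ 0# 1#

sumℤ : ∀ {n} → Vector ℤ n → ℤ
sumℤ {zero}  v = + 0
sumℤ {suc n} v = v Fin.zero ℤ.+ sumℤ (λ i → v (Fin.suc i))
  where import Data.Fin as Fin

module _ (R : RealField) where
  open RealField R

  sumR : ∀ {n} → Vector Carrier n → Carrier
  sumR {zero}  v = 0#
  sumR {suc n} v = v Fin.zero + sumR (λ i → v (Fin.suc i))
    where import Data.Fin as Fin

  WeaklyDependent : (N : ℕ) {n : ℕ} → Vector Carrier n → Set
  WeaklyDependent N {n} γ =
    Σ (Vector ℤ n) λ α →
        ¬ (∀ i → α i ≡ + 0)
      × sumR (λ i → fromℤ (α i) * γ i) ≡ 0#
      × (∀ i → ∣ α i ∣ ℕ.≤ suc N)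
      × (∀ i j → ∣ α i ∣ ≡ suc N → ∣ α j ∣ ≡ suc N → i ≡ j)

  -- K γ' = ⌊ K γ ⌋ ; the generator combination Σ aᵢ (eᵢ + Kγᵢ' e_{n+1})
  latticeVec : (K : ℤ) {n : ℕ} → Vector Carrier n → Vector ℤ n → Vector ℤ (n ℕ.+ 1)
  latticeVec K γ a = a ++ (λ _ → sumℤ (λ i → a i ℤ.* ⌊ fromℤ K * γ i ⌋))

  InLattice : (K : ℤ) {n : ℕ} → Vector Carrier n → Vector ℤ (n ℕ.+ 1) → Set
  InLattice K γ v = Σ (Vector ℤ _) λ a → ∀ i → v i ≡ latticeVec K γ a i

normSq : ∀ {m} → Vector ℤ m → ℤ
normSq v = sumℤ (λ i → v i ℤ.* v i)

IsNonzero : ∀ {m} → Vector ℤ m → Set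
IsNonzero v = ¬ (∀ i → v i ≡ + 0)

-- Take for v the lattice vector of the relation α itself: v = (α, L) with
-- L = Σ αᵢ⌊Kγᵢ⌋.  Since Σ αᵢKγᵢ = 0, L = −Σ αᵢθᵢ where θᵢ ∈ [0,1) is the
-- fractional part of Kγᵢ, so |L| < Σ|αᵢ| (strictly, because α ≠ 0).  All |αᵢ|
-- are ≤ N except at most one, which is ≤ N + 1; hence Σ|αᵢ| ≤ nN + 1, so
-- |L| ≤ nN, and Σ αᵢ² ≤ nN² + 2N + 1, giving |v|² ≤ (n² + n)N² + 2N + 1.
module Submission where

open import Defs
open import Level using (0ℓ)
open import Function using (_∘_)
open import Function.Definitions using (Injective)
open import Data.Nat as ℕ using (ℕ; zero; suc)
import Data.Nat.Properties as ℕP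
open import Data.Nat.Tactic.RingSolver using (solve-∀)
open import Data.Integer as ℤ using (ℤ; +_; -[1+_]; ∣_∣)
import Data.Integer.Properties as ℤP
open import Data.Fin using (Fin; zero; suc; splitAt; _↑ˡ_)
open import Data.Fin.Properties as FinP using (¬∀⟶∃¬)
open import Data.Vec.Functional using (Vector; tail; _++_)
open import Data.Vec.Functional.Properties using (lookup-++ˡ)
open import Data.Product using (Σ; _×_; _,_; proj₁)
open import Data.Sum using (inj₁; inj₂)
open import Relation.Nullary using (¬_; yes; no; contradiction)
open import Relation.Binary.Core using (Rel)
open import Relation.Binary.Structures using (IsTotalOrder)
open import Relation.Binary.PropositionalEquality
open import Algebra.Bundles using (CommutativeRing)
open import Algebra.Structures using (IsCommutativeRing)
open import Algebra.Properties.CommutativeSemigroup ℕP.+-commutativeSemigroup using (xy∙z≈zy∙x)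
open import Algebra.Properties.Monoid.Sum ℕP.+-0-monoid
  using () renaming (sum to sumℕ; sum-cong-≗ to sumℕ-cong-≗)

module RealFieldProperties (R : RealField) where
  open RealField R
  open ≡-Reasoning
  open IsCommutativeRing isCommutativeRing
    using (+-comm; +-assoc; +-identityˡ; +-identityʳ; -‿inverseʳ;
           distribˡ; distribʳ; zeroˡ; zeroʳ; *-identityˡ)
  open IsTotalOrder isTotalOrder using (total; antisym)
    renaming (refl to ≤-refl; trans to ≤-trans)

  commutativeRing : CommutativeRing 0ℓ 0ℓ
  commutativeRing = record { isCommutativeRing = isCommutativeRing }

  open CommutativeRing commutativeRing
    using (ring; semiring; +-commutativeMonoid; *-commutativeSemigroup)
  open import Algebra.Properties.CommutativeSemigroup *-commutativeSemigroup using (x∙yz≈y∙xz)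
  open import Algebra.Properties.Ring ring
    using (-‿distribˡ-*; -‿distribʳ-*; -0#≈0#; -‿involutive; -‿+-comm; +-cancelʳ; xyx⁻¹≈y; -1*x≈-x)
  open import Algebra.Properties.Semiring.Mult semiring using (×-homo-+; ×1-homo-*)
    renaming (_×_ to _×′_)
  open import Algebra.Properties.CommutativeMonoid.Sum +-commutativeMonoid
    using (sum; sum-cong-≗; ∑-distrib-+)
  open import Algebra.Properties.Semiring.Sum semiring using (*-distribˡ-sum)

  sumR≡sum : ∀ {n} (t : Vector Carrier n) → sumR R t ≡ sum t
  sumR≡sum {zero}  t = refl
  sumR≡sum {suc n} t = cong (_+_ (t zero)) (sumR≡sum (tail t))

  sum-neg : ∀ {n} (t : Vector Carrier n) → sum (λ i → - t i) ≡ - sum t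
  sum-neg {zero}  t = sym -0#≈0#
  sum-neg {suc n} t = trans (cong (_+_ (- t zero)) (sum-neg (tail t))) (-‿+-comm _ _)

  fromℕ : ℕ → Carrier
  fromℕ = embℕ _+_ 0# 1#

  fromℕ≡×1# : ∀ n → fromℕ n ≡ n ×′ 1#
  fromℕ≡×1# zero    = refl
  fromℕ≡×1# (suc n) = cong (_+_ 1#) (fromℕ≡×1# n)

  fromℕ-+ : ∀ m n → fromℕ (m ℕ.+ n) ≡ fromℕ m + fromℕ n
  fromℕ-+ m n = begin
    fromℕ (m ℕ.+ n)      ≡⟨ fromℕ≡×1# (m ℕ.+ n) ⟩
    (m ℕ.+ n) ×′ 1#      ≡⟨ ×-homo-+ 1# m n ⟩
    m ×′ 1# + n ×′ 1#    ≡⟨ cong₂ _+_ (fromℕ≡×1# m) (fromℕ≡×1# n) ⟨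
    fromℕ m + fromℕ n    ∎

  fromℕ-* : ∀ m n → fromℕ (m ℕ.* n) ≡ fromℕ m * fromℕ n
  fromℕ-* m n = begin
    fromℕ (m ℕ.* n)          ≡⟨ fromℕ≡×1# (m ℕ.* n) ⟩
    (m ℕ.* n) ×′ 1#          ≡⟨ ×1-homo-* m n ⟩
    (m ×′ 1#) * (n ×′ 1#)    ≡⟨ cong₂ _*_ (fromℕ≡×1# m) (fromℕ≡×1# n) ⟨
    fromℕ m * fromℕ n        ∎

  fromℤ-⊖ : ∀ m n → fromℤ (m ℤ.⊖ n) ≡ fromℕ m + - fromℕ n
  fromℤ-⊖ m       zero    = sym (trans (cong (_+_ (fromℕ m)) -0#≈0#) (+-identityʳ _))
  fromℤ-⊖ zero    (suc n) = sym (+-identityˡ _)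
  fromℤ-⊖ (suc m) (suc n) = begin
    fromℤ (suc m ℤ.⊖ suc n)                ≡⟨ cong fromℤ (ℤP.[1+m]⊖[1+n]≡m⊖n m n) ⟩
    fromℤ (m ℤ.⊖ n)                        ≡⟨ fromℤ-⊖ m n ⟩
    fromℕ m + - fromℕ n                    ≡⟨ cong (_+ - fromℕ n) (xyx⁻¹≈y 1# (fromℕ m)) ⟨
    1# + fromℕ m + - 1# + - fromℕ n        ≡⟨ +-assoc (1# + fromℕ m) (- 1#) (- fromℕ n) ⟩
    1# + fromℕ m + (- 1# + - fromℕ n)      ≡⟨ cong (_+_ (1# + fromℕ m)) (-‿+-comm 1# (fromℕ n)) ⟩
    1# + fromℕ m + - (1# + fromℕ n)        ∎

  fromℤ-neg : ∀ i → fromℤ (ℤ.- i) ≡ - fromℤ i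
  fromℤ-neg (+ zero)  = sym -0#≈0#
  fromℤ-neg (+ suc n) = refl
  fromℤ-neg -[1+ n ]  = sym (-‿involutive _)

  fromℤ-+ : ∀ i j → fromℤ (i ℤ.+ j) ≡ fromℤ i + fromℤ j
  fromℤ-+ (+ m)    (+ n)    = fromℕ-+ m n
  fromℤ-+ (+ m)    -[1+ n ] = fromℤ-⊖ m (suc n)
  fromℤ-+ -[1+ m ] (+ n)    = trans (fromℤ-⊖ n (suc m)) (+-comm _ _)
  fromℤ-+ -[1+ m ] -[1+ n ] = begin
    - fromℕ (suc (suc (m ℕ.+ n)))             ≡⟨ cong (λ k → - fromℕ (suc k)) (ℕP.+-suc m n) ⟨
    - fromℕ (suc m ℕ.+ suc n)                 ≡⟨ cong -_ (fromℕ-+ (suc m) (suc n)) ⟩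
    - (fromℕ (suc m) + fromℕ (suc n))         ≡⟨ -‿+-comm _ _ ⟨
    - fromℕ (suc m) + - fromℕ (suc n)         ∎

  fromℤ-+* : ∀ m j → fromℤ (+ m ℤ.* j) ≡ fromℕ m * fromℤ j
  fromℤ-+* m (+ n)    = trans (cong fromℤ (sym (ℤP.pos-* m n))) (fromℕ-* m n)
  fromℤ-+* m -[1+ n ] = begin
    fromℤ (+ m ℤ.* ℤ.- + suc n)       ≡⟨ cong fromℤ (ℤP.neg-distribʳ-* (+ m) (+ suc n)) ⟨
    fromℤ (ℤ.- (+ m ℤ.* + suc n))     ≡⟨ fromℤ-neg (+ m ℤ.* + suc n) ⟩
    - fromℤ (+ m ℤ.* + suc n)         ≡⟨ cong -_ (fromℤ-+* m (+ suc n)) ⟩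
    - (fromℕ m * fromℕ (suc n))       ≡⟨ -‿distribʳ-* _ _ ⟩
    fromℕ m * - fromℕ (suc n)         ∎

  fromℤ-* : ∀ i j → fromℤ (i ℤ.* j) ≡ fromℤ i * fromℤ j
  fromℤ-* (+ m)    j = fromℤ-+* m j
  fromℤ-* -[1+ m ] j = begin
    fromℤ (ℤ.- + suc m ℤ.* j)         ≡⟨ cong fromℤ (ℤP.neg-distribˡ-* (+ suc m) j) ⟨
    fromℤ (ℤ.- (+ suc m ℤ.* j))       ≡⟨ fromℤ-neg (+ suc m ℤ.* j) ⟩
    - fromℤ (+ suc m ℤ.* j)           ≡⟨ cong -_ (fromℤ-+* (suc m) j) ⟩
    - (fromℕ (suc m) * fromℤ j)       ≡⟨ -‿distribˡ-* _ _ ⟩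
    - fromℕ (suc m) * fromℤ j         ∎

  sum-fromℕ : ∀ {n} (b : Vector ℕ n) → sum (λ i → fromℕ (b i)) ≡ fromℕ (sumℕ b)
  sum-fromℕ {zero}  b = refl
  sum-fromℕ {suc n} b =
    trans (cong (_+_ (fromℕ (b zero))) (sum-fromℕ (tail b))) (sym (fromℕ-+ (b zero) _))

  sum-fromℤ : ∀ {n} (w : Vector ℤ n) → sum (λ i → fromℤ (w i)) ≡ fromℤ (sumℤ w)
  sum-fromℤ {zero}  w = refl
  sum-fromℤ {suc n} w =
    trans (cong (_+_ (fromℤ (w zero))) (sum-fromℤ (tail w))) (sym (fromℤ-+ (w zero) _))

  infix 4 _<_
  _<_ : Rel Carrier 0ℓ
  x < y = x ≤ y × x ≢ y

  ≤-<-trans : ∀ {x y z} → x ≤ y → y < z → x < z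
  ≤-<-trans x≤y (y≤z , y≢z) = ≤-trans x≤y y≤z , λ { refl → y≢z (antisym y≤z x≤y) }

  +-monoʳ-≤ : ∀ z {x y} → x ≤ y → z + x ≤ z + y
  +-monoʳ-≤ z {x} {y} x≤y = subst₂ _≤_ (+-comm x z) (+-comm y z) (+-monoˡ-≤ z x≤y)

  +-mono-≤ : ∀ {x y u v} → x ≤ y → u ≤ v → x + u ≤ y + v
  +-mono-≤ {y = y} {u} x≤y u≤v = ≤-trans (+-monoˡ-≤ u x≤y) (+-monoʳ-≤ y u≤v)

  +-monoˡ-< : ∀ z {x y} → x < y → x + z < y + z
  +-monoˡ-< z (x≤y , x≢y) = +-monoˡ-≤ z x≤y , λ eq → x≢y (+-cancelʳ z _ _ eq)

  +-mono-<-≤ : ∀ {x y u v} → x < y → u ≤ v → x + u < y + v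
  +-mono-<-≤ {x} {v = v} x<y u≤v = ≤-<-trans (+-monoʳ-≤ x u≤v) (+-monoˡ-< v x<y)

  +-mono-≤-< : ∀ {x y u v} → x ≤ y → u < v → x + u < y + v
  +-mono-≤-< {x} {y} {u} {v} x≤y u<v = subst₂ _<_ (+-comm u x) (+-comm v y) (+-mono-<-≤ u<v x≤y)

  x≤y⇒0≤y-x : ∀ {x y} → x ≤ y → 0# ≤ y + - x
  x≤y⇒0≤y-x {x} x≤y = subst (_≤ _) (-‿inverseʳ x) (+-monoˡ-≤ (- x) x≤y)

  0≤x⇒-x≤0 : ∀ {x} → 0# ≤ x → - x ≤ 0#
  0≤x⇒-x≤0 {x} 0≤x = subst₂ _≤_ (+-identityˡ (- x)) (-‿inverseʳ x) (+-monoˡ-≤ (- x) 0≤x)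

  -- If 1 ≤ 0 then 0 ≤ -1, and 1 = (-1)(-1) is nonnegative all the same.
  0≤1 : 0# ≤ 1#
  0≤1 with total 0# 1#
  ... | inj₁ 0≤1 = 0≤1
  ... | inj₂ 1≤0 = subst (0# ≤_) -1*-1≡1 (*-nonneg 0≤-1 0≤-1)
    where
    0≤-1 : 0# ≤ - 1#
    0≤-1 = subst (0# ≤_) (+-identityˡ (- 1#)) (x≤y⇒0≤y-x 1≤0)
    -1*-1≡1 : - 1# * - 1# ≡ 1#
    -1*-1≡1 = trans (-1*x≈-x (- 1#)) (-‿involutive 1#)

  0≤fromℕ : ∀ n → 0# ≤ fromℕ n
  0≤fromℕ zero    = ≤-refl
  0≤fromℕ (suc n) = subst (_≤ fromℕ (suc n)) (+-identityˡ 0#) (+-mono-≤ 0≤1 (0≤fromℕ n))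

  0<fromℕ-suc : ∀ n → 0# < fromℕ (suc n)
  0<fromℕ-suc n = subst (_< fromℕ (suc n)) (+-identityʳ 0#) (+-mono-<-≤ (0≤1 , 0≢1) (0≤fromℕ n))

  fromℕ-mono-≤ : ∀ {m n} → m ℕ.≤ n → fromℕ m ≤ fromℕ n
  fromℕ-mono-≤ {m} {n} m≤n = subst₂ _≤_ (+-identityʳ (fromℕ m)) fromℕ[m+[n∸m]]≡fromℕn
                               (+-monoʳ-≤ (fromℕ m) (0≤fromℕ (n ℕ.∸ m)))
    where
    fromℕ[m+[n∸m]]≡fromℕn : fromℕ m + fromℕ (n ℕ.∸ m) ≡ fromℕ n
    fromℕ[m+[n∸m]]≡fromℕn = trans (sym (fromℕ-+ m (n ℕ.∸ m))) (cong fromℕ (ℕP.m+[n∸m]≡n m≤n))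

  fromℕ-cancel-< : ∀ {m n} → fromℕ m < fromℕ n → m ℕ.< n
  fromℕ-cancel-< {m} {n} (m≤n , m≢n) with m ℕ.<? n
  ... | yes m<n = m<n
  ... | no  m≮n = contradiction (antisym m≤n (fromℕ-mono-≤ (ℕP.≮⇒≥ m≮n))) m≢n

  ∣∣-cancel-< : ∀ i n → fromℤ i < fromℕ n → - fromℤ i < fromℕ n → ∣ i ∣ ℕ.< n
  ∣∣-cancel-< (+ m)    n m<n _  = fromℕ-cancel-< m<n
  ∣∣-cancel-< -[1+ m ] n _ -i<n = fromℕ-cancel-< (subst (_< fromℕ n) (-‿involutive _) -i<n)

  sum-mono-≤ : ∀ {n} {t u : Vector Carrier n} → (∀ i → t i ≤ u i) → sum t ≤ sum u
  sum-mono-≤ {zero}  t≤u = ≤-refl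
  sum-mono-≤ {suc n} t≤u = +-mono-≤ (t≤u zero) (sum-mono-≤ (t≤u ∘ suc))

  sum-mono-< : ∀ {n} {t u : Vector Carrier n} → (∀ i → t i ≤ u i) → ∀ j → t j < u j → sum t < sum u
  sum-mono-< t≤u zero    t₀<u₀ = +-mono-<-≤ t₀<u₀ (sum-mono-≤ (t≤u ∘ suc))
  sum-mono-< t≤u (suc j) tⱼ<uⱼ = +-mono-≤-< (t≤u zero) (sum-mono-< (t≤u ∘ suc) j tⱼ<uⱼ)

  fromℕ-suc-* : ∀ n x → fromℕ (suc n) * x ≡ x + fromℕ n * x
  fromℕ-suc-* n x = trans (distribʳ x 1# (fromℕ n)) (cong (_+ fromℕ n * x) (*-identityˡ x))

  fromℕ-*-≤ : ∀ {θ} → θ ≤ 1# → ∀ n → fromℕ n * θ ≤ fromℕ n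
  fromℕ-*-≤ {θ} θ≤1 zero    = subst (_≤ 0#) (sym (zeroˡ θ)) ≤-refl
  fromℕ-*-≤ {θ} θ≤1 (suc n) =
    subst (_≤ fromℕ (suc n)) (sym (fromℕ-suc-* n θ)) (+-mono-≤ θ≤1 (fromℕ-*-≤ θ≤1 n))

  fromℕ-suc-*-< : ∀ {θ} → θ < 1# → ∀ n → fromℕ (suc n) * θ < fromℕ (suc n)
  fromℕ-suc-*-< {θ} θ<1 n =
    subst (_< fromℕ (suc n)) (sym (fromℕ-suc-* n θ)) (+-mono-<-≤ θ<1 (fromℕ-*-≤ (proj₁ θ<1) n))

  -[1+n]*-≤0 : ∀ {θ} → 0# ≤ θ → ∀ n → fromℤ -[1+ n ] * θ ≤ 0#
  -[1+n]*-≤0 {θ} 0≤θ n = subst (_≤ 0#) (-‿distribˡ-* (fromℕ (suc n)) θ)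
                           (0≤x⇒-x≤0 (*-nonneg (0≤fromℕ (suc n)) 0≤θ))

  fromℤ-*-≤ : ∀ {θ} → 0# ≤ θ → θ ≤ 1# → ∀ a → fromℤ a * θ ≤ fromℕ ∣ a ∣
  fromℤ-*-≤ _   θ≤1 (+ n)    = fromℕ-*-≤ θ≤1 n
  fromℤ-*-≤ 0≤θ _   -[1+ n ] = ≤-trans (-[1+n]*-≤0 0≤θ n) (0≤fromℕ (suc n))

  fromℤ-*-< : ∀ {θ} → 0# ≤ θ → θ < 1# → ∀ a → a ≢ + 0 → fromℤ a * θ < fromℕ ∣ a ∣
  fromℤ-*-< _   _   (+ zero)  a≢0 = contradiction refl a≢0
  fromℤ-*-< _   θ<1 (+ suc n) _   = fromℕ-suc-*-< θ<1 n
  fromℤ-*-< 0≤θ _   -[1+ n ]  _   = ≤-<-trans (-[1+n]*-≤0 0≤θ n) (0<fromℕ-suc n)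

  sum-*-<-∑∣∣ : ∀ {n} (α : Vector ℤ n) → ¬ (∀ i → α i ≡ + 0) → (θ : Vector Carrier n) →
                (∀ i → 0# ≤ θ i) → (∀ i → θ i < 1#) →
                sum (λ i → fromℤ (α i) * θ i) < fromℕ (sumℕ (λ i → ∣ α i ∣))
  sum-*-<-∑∣∣ {n} α α≢0 θ 0≤θ θ<1 with ¬∀⟶∃¬ n (λ i → α i ≡ + 0) (λ i → α i ℤ.≟ + 0) α≢0
  ... | j , αⱼ≢0 = subst (sum (λ i → fromℤ (α i) * θ i) <_) (sum-fromℕ (λ i → ∣ α i ∣))
                     (sum-mono-< termᵢ≤ j (fromℤ-*-< (0≤θ j) (θ<1 j) (α j) αⱼ≢0))
    where
    termᵢ≤ : ∀ i → fromℤ (α i) * θ i ≤ fromℕ ∣ α i ∣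
    termᵢ≤ i = fromℤ-*-≤ (0≤θ i) (proj₁ (θ<1 i)) (α i)

  IsRelation : ∀ {n} → Vector ℤ n → Vector Carrier n → Set
  IsRelation α x = sum (λ i → fromℤ (α i) * x i) ≡ 0#

  isRelation-scale : ∀ {n} (c : Carrier) (α : Vector ℤ n) (x : Vector Carrier n) →
                     IsRelation α x → IsRelation α (λ i → c * x i)
  isRelation-scale c α x rel = begin
    sum (λ i → fromℤ (α i) * (c * x i))   ≡⟨ sum-cong-≗ (λ i → x∙yz≈y∙xz (fromℤ (α i)) c (x i)) ⟩
    sum (λ i → c * (fromℤ (α i) * x i))   ≡⟨ *-distribˡ-sum c (λ i → fromℤ (α i) * x i) ⟨
    c * sum (λ i → fromℤ (α i) * x i)     ≡⟨ cong (c *_) rel ⟩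
    c * 0#                                ≡⟨ zeroʳ c ⟩
    0#                                    ∎

  fracPart : Carrier → Carrier
  fracPart x = x + - fromℤ ⌊ x ⌋

  0≤fracPart : ∀ x → 0# ≤ fracPart x
  0≤fracPart x = x≤y⇒0≤y-x (⌊⌋-lower x)

  fracPart<1 : ∀ x → fracPart x < 1#
  fracPart<1 x = subst (fracPart x <_) (xyx⁻¹≈y ⌊x⌋ 1#)
                   (+-monoˡ-< (- ⌊x⌋) (⌊⌋-upper x))
    where ⌊x⌋ = fromℤ ⌊ x ⌋

  sum-*-fracPart : ∀ {n} (α : Vector ℤ n) (x : Vector Carrier n) → IsRelation α x →
                   sum (λ i → fromℤ (α i) * fracPart (x i)) ≡ - fromℤ (sumℤ (λ i → α i ℤ.* ⌊ x i ⌋))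
  sum-*-fracPart α x rel = begin
    sum (λ i → fromℤ (α i) * fracPart (x i))   ≡⟨ sum-cong-≗ split ⟩
    sum (λ i → αx i + - fromℤ (α⌊x⌋ i))        ≡⟨ ∑-distrib-+ αx (λ i → - fromℤ (α⌊x⌋ i)) ⟩
    sum αx + sum (λ i → - fromℤ (α⌊x⌋ i))      ≡⟨ cong₂ _+_ rel (sum-neg (fromℤ ∘ α⌊x⌋)) ⟩
    0# + - sum (fromℤ ∘ α⌊x⌋)                  ≡⟨ +-identityˡ _ ⟩
    - sum (fromℤ ∘ α⌊x⌋)                       ≡⟨ cong -_ (sum-fromℤ α⌊x⌋) ⟩
    - fromℤ (sumℤ α⌊x⌋)                        ∎
    where
    αx : Vector Carrier _
    αx i = fromℤ (α i) * x i
    α⌊x⌋ : Vector ℤ _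
    α⌊x⌋ i = α i ℤ.* ⌊ x i ⌋
    split : ∀ i → fromℤ (α i) * fracPart (x i) ≡ αx i + - fromℤ (α⌊x⌋ i)
    split i = begin
      a * (x i + - fromℤ ⌊ x i ⌋)           ≡⟨ distribˡ a (x i) _ ⟩
      a * x i + a * - fromℤ ⌊ x i ⌋         ≡⟨ cong (_+_ (a * x i)) (-‿distribʳ-* a _) ⟨
      a * x i + - (a * fromℤ ⌊ x i ⌋)       ≡⟨ cong (λ y → a * x i + - y) (fromℤ-* (α i) ⌊ x i ⌋) ⟨
      a * x i + - fromℤ (α i ℤ.* ⌊ x i ⌋)   ∎
      where a = fromℤ (α i)

  ∣∑-*-⌊⌋∣<∑∣∣ : ∀ {n} (α : Vector ℤ n) → ¬ (∀ i → α i ≡ + 0) → (x : Vector Carrier n) →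
                IsRelation α x → ∣ sumℤ (λ i → α i ℤ.* ⌊ x i ⌋) ∣ ℕ.< sumℕ (λ i → ∣ α i ∣)
  ∣∑-*-⌊⌋∣<∑∣∣ α α≢0 x rel = ∣∣-cancel-< L _ L<S -L<S
    where
    L = sumℤ (λ i → α i ℤ.* ⌊ x i ⌋)
    θ = λ i → fracPart (x i)
    T = sum (λ i → fromℤ (α i) * θ i)

    T<S : T < fromℕ (sumℕ (λ i → ∣ α i ∣))
    T<S = sum-*-<-∑∣∣ α α≢0 θ (0≤fracPart ∘ x) (fracPart<1 ∘ x)

    -T<S : - T < fromℕ (sumℕ (λ i → ∣ α i ∣))
    -T<S = subst₂ _<_ sum-neg-α (cong fromℕ (sumℕ-cong-≗ (λ i → ℤP.∣-i∣≡∣i∣ (α i))))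
             (sum-*-<-∑∣∣ (λ i → ℤ.- α i) (λ -α≡0 → α≢0 (λ i → ℤP.neg-injective (-α≡0 i))) θ
                          (0≤fracPart ∘ x) (fracPart<1 ∘ x))
      where
      sum-neg-α : sum (λ i → fromℤ (ℤ.- α i) * θ i) ≡ - T
      sum-neg-α = trans (sum-cong-≗ (λ i → trans (cong (_* θ i) (fromℤ-neg (α i)))
                                                  (sym (-‿distribˡ-* (fromℤ (α i)) (θ i)))))
                        (sum-neg (λ i → fromℤ (α i) * θ i))

    T≡-L : T ≡ - fromℤ L
    T≡-L = sum-*-fracPart α x rel

    L<S : fromℤ L < fromℕ (sumℕ (λ i → ∣ α i ∣))
    L<S = subst (_< _) (trans (cong -_ T≡-L) (-‿involutive _)) -T<S

    -L<S : - fromℤ L < fromℕ (sumℕ (λ i → ∣ α i ∣))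
    -L<S = subst (_< _) T≡-L T<S

sumℕ-≤-bounded : ∀ (g : ℕ → ℕ) → (∀ {x y} → x ℕ.≤ y → g x ℕ.≤ g y) → ∀ N {n} (b : Vector ℕ n) →
                 (∀ i → b i ℕ.≤ N) → sumℕ (λ i → g (b i)) ℕ.≤ n ℕ.* g N
sumℕ-≤-bounded g g-mono N {zero}  b b≤N = ℕ.z≤n
sumℕ-≤-bounded g g-mono N {suc n} b b≤N =
  ℕP.+-mono-≤ (g-mono (b≤N zero)) (sumℕ-≤-bounded g g-mono N (tail b) (b≤N ∘ suc))

sumℕ-≤-weaklyBounded : ∀ (g : ℕ → ℕ) → (∀ {x y} → x ℕ.≤ y → g x ℕ.≤ g y) →
                       ∀ N {n} (b : Vector ℕ n) →
                       (∀ i → b i ℕ.≤ suc N) → (∀ i j → b i ≡ suc N → b j ≡ suc N → i ≡ j) →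
                       sumℕ (λ i → g (b i)) ℕ.+ g N ℕ.≤ n ℕ.* g N ℕ.+ g (suc N)
sumℕ-≤-weaklyBounded g g-mono N {zero}  b b≤1+N unique = g-mono (ℕP.n≤1+n N)
sumℕ-≤-weaklyBounded g g-mono N {suc n} b b≤1+N unique with b zero ℕ.≟ suc N
... | yes b₀≡1+N = begin
  g (b zero) ℕ.+ sumℕ (λ i → g (b (suc i))) ℕ.+ g N   ≤⟨ ℕP.+-monoˡ-≤ (g N) (ℕP.+-monoʳ-≤ _ rest≤) ⟩
  g (b zero) ℕ.+ n ℕ.* g N ℕ.+ g N                    ≡⟨ cong (λ k → g k ℕ.+ n ℕ.* g N ℕ.+ g N) b₀≡1+N ⟩
  g (suc N) ℕ.+ n ℕ.* g N ℕ.+ g N                     ≡⟨ xy∙z≈zy∙x (g (suc N)) (n ℕ.* g N) (g N) ⟩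
  g N ℕ.+ n ℕ.* g N ℕ.+ g (suc N)                     ∎
  where
  open ℕP.≤-Reasoning
  bᵢ≢1+N : ∀ i → b (suc i) ≢ suc N
  bᵢ≢1+N i bᵢ≡1+N = FinP.0≢1+n (unique zero (suc i) b₀≡1+N bᵢ≡1+N)
  rest≤ : sumℕ (λ i → g (b (suc i))) ℕ.≤ n ℕ.* g N
  rest≤ = sumℕ-≤-bounded g g-mono N (tail b) (λ i → ℕP.≤-pred (ℕP.≤∧≢⇒< (b≤1+N (suc i)) (bᵢ≢1+N i)))
... | no  b₀≢1+N = begin
  g (b zero) ℕ.+ sumℕ (λ i → g (b (suc i))) ℕ.+ g N   ≡⟨ ℕP.+-assoc (g (b zero)) _ (g N) ⟩
  g (b zero) ℕ.+ (sumℕ (λ i → g (b (suc i))) ℕ.+ g N) ≤⟨ ℕP.+-mono-≤ (g-mono b₀≤N) rest≤ ⟩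
  g N ℕ.+ (n ℕ.* g N ℕ.+ g (suc N))                   ≡⟨ ℕP.+-assoc (g N) (n ℕ.* g N) (g (suc N)) ⟨
  g N ℕ.+ n ℕ.* g N ℕ.+ g (suc N)                     ∎
  where
  open ℕP.≤-Reasoning
  b₀≤N : b zero ℕ.≤ N
  b₀≤N = ℕP.≤-pred (ℕP.≤∧≢⇒< (b≤1+N zero) b₀≢1+N)
  rest≤ : sumℕ (λ i → g (b (suc i))) ℕ.+ g N ℕ.≤ n ℕ.* g N ℕ.+ g (suc N)
  rest≤ = sumℕ-≤-weaklyBounded g g-mono N (tail b) (b≤1+N ∘ suc)
            (λ i j bᵢ≡1+N bⱼ≡1+N → FinP.suc-injective (unique (suc i) (suc j) bᵢ≡1+N bⱼ≡1+N))

norm-bound : ∀ n N S Q l → S ℕ.+ N ℕ.≤ n ℕ.* N ℕ.+ suc N →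
             Q ℕ.+ N ℕ.* N ℕ.≤ n ℕ.* (N ℕ.* N) ℕ.+ suc N ℕ.* suc N → l ℕ.< S →
             Q ℕ.+ l ℕ.* l ℕ.< (n ℕ.* n ℕ.+ n) ℕ.* (N ℕ.* N) ℕ.+ (2 ℕ.* n ℕ.+ 2) ℕ.* N ℕ.+ 2
norm-bound n N S Q l S≤ Q≤ l<S = ℕP.+-cancelʳ-≤ (N ℕ.* N) _ _ (begin
  suc (Q ℕ.+ l ℕ.* l) ℕ.+ N ℕ.* N
    ≡⟨ regroup Q l N ⟩
  (Q ℕ.+ N ℕ.* N) ℕ.+ l ℕ.* l ℕ.+ 1
    ≤⟨ ℕP.+-mono-≤ (ℕP.+-mono-≤ Q≤ (ℕP.*-mono-≤ l≤nN l≤nN)) (ℕP.m≤n+m 1 (2 ℕ.* n ℕ.* N)) ⟩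
  (n ℕ.* (N ℕ.* N) ℕ.+ suc N ℕ.* suc N) ℕ.+ (n ℕ.* N) ℕ.* (n ℕ.* N) ℕ.+ (2 ℕ.* n ℕ.* N ℕ.+ 1)
    ≡⟨ expand n N ⟩
  (n ℕ.* n ℕ.+ n) ℕ.* (N ℕ.* N) ℕ.+ (2 ℕ.* n ℕ.+ 2) ℕ.* N ℕ.+ 2 ℕ.+ N ℕ.* N ∎)
  where
  open ℕP.≤-Reasoning
  l≤nN : l ℕ.≤ n ℕ.* N
  l≤nN = ℕP.+-cancelʳ-≤ N l (n ℕ.* N) (ℕP.≤-pred (begin
    suc l ℕ.+ N         ≤⟨ ℕP.+-monoˡ-≤ N l<S ⟩
    S ℕ.+ N             ≤⟨ S≤ ⟩
    n ℕ.* N ℕ.+ suc N   ≡⟨ ℕP.+-suc (n ℕ.* N) N ⟩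
    suc (n ℕ.* N ℕ.+ N) ∎))
  regroup : ∀ Q l N → suc (Q ℕ.+ l ℕ.* l) ℕ.+ N ℕ.* N ≡ (Q ℕ.+ N ℕ.* N) ℕ.+ l ℕ.* l ℕ.+ 1
  regroup = solve-∀
  expand : ∀ n N → (n ℕ.* (N ℕ.* N) ℕ.+ suc N ℕ.* suc N) ℕ.+ (n ℕ.* N) ℕ.* (n ℕ.* N)
                     ℕ.+ (2 ℕ.* n ℕ.* N ℕ.+ 1)
                   ≡ (n ℕ.* n ℕ.+ n) ℕ.* (N ℕ.* N) ℕ.+ (2 ℕ.* n ℕ.+ 2) ℕ.* N ℕ.+ 2 ℕ.+ N ℕ.* N
  expand = solve-∀

sumℤ-cong : ∀ {n} {u v : Vector ℤ n} → (∀ i → u i ≡ v i) → sumℤ u ≡ sumℤ v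
sumℤ-cong {zero}  u≗v = refl
sumℤ-cong {suc n} u≗v = cong₂ ℤ._+_ (u≗v zero) (sumℤ-cong (u≗v ∘ suc))

++-suc : ∀ {m k} (a : Vector ℤ (suc m)) (c : Vector ℤ k) i → (a ++ c) (suc i) ≡ (tail a ++ c) i
++-suc {m} a c i with splitAt m i
... | inj₁ _ = refl
... | inj₂ _ = refl

normSq-++ : ∀ {m k} (a : Vector ℤ m) (c : Vector ℤ k) → normSq (a ++ c) ≡ normSq a ℤ.+ normSq c
normSq-++ {zero}  a c = sym (ℤP.+-identityˡ (normSq c))
normSq-++ {suc m} a c = trans (cong (ℤ._+_ (a zero ℤ.* a zero)) normSq-tail)
                              (sym (ℤP.+-assoc (a zero ℤ.* a zero) (normSq (tail a)) (normSq c)))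
  where
  normSq-tail : sumℤ (λ i → (a ++ c) (suc i) ℤ.* (a ++ c) (suc i)) ≡ normSq (tail a) ℤ.+ normSq c
  normSq-tail = trans (sumℤ-cong (λ i → cong (λ z → z ℤ.* z) (++-suc a c i))) (normSq-++ (tail a) c)

i*i≡∣i∣*∣i∣ : ∀ i → i ℤ.* i ≡ + (∣ i ∣ ℕ.* ∣ i ∣)
i*i≡∣i∣*∣i∣ (+ n)    = ℤP.+◃n≡+n (n ℕ.* n)
i*i≡∣i∣*∣i∣ -[1+ n ] = ℤP.+◃n≡+n (suc n ℕ.* suc n)

normSq≡sumℕ : ∀ {m} (a : Vector ℤ m) → normSq a ≡ + sumℕ (λ i → ∣ a i ∣ ℕ.* ∣ a i ∣)
normSq≡sumℕ {zero}  a = refl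
normSq≡sumℕ {suc m} a = cong₂ ℤ._+_ (i*i≡∣i∣*∣i∣ (a zero)) (normSq≡sumℕ (tail a))

normSq-++-const : ∀ {m} (a : Vector ℤ m) (c : ℤ) →
                  normSq (a ++ (λ (_ : Fin 1) → c))
                    ≡ + (sumℕ (λ i → ∣ a i ∣ ℕ.* ∣ a i ∣) ℕ.+ ∣ c ∣ ℕ.* ∣ c ∣)
normSq-++-const a c = trans (normSq-++ a (λ _ → c))
  (trans (cong₂ ℤ._+_ (normSq≡sumℕ a) (normSq≡sumℕ (λ (_ : Fin 1) → c)))
         (cong (λ k → + (sumℕ (λ i → ∣ a i ∣ ℕ.* ∣ a i ∣) ℕ.+ k)) (ℕP.+-identityʳ (∣ c ∣ ℕ.* ∣ c ∣))))

++-nonzeroˡ : ∀ {m k} {a : Vector ℤ m} (c : Vector ℤ k) → IsNonzero a → IsNonzero (a ++ c)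
++-nonzeroˡ {a = a} c a≢0 a++c≡0 = a≢0 (λ i → trans (sym (lookup-++ˡ a c i)) (a++c≡0 (i ↑ˡ _)))

lemma1 : (R : RealField) (K : ℤ) → ¬ (K ≡ + 0) → (N n : ℕ)
         (γ : Vector (RealField.Carrier R) n) → Injective _≡_ _≡_ γ →
         WeaklyDependent R N γ →
         Σ (Vector ℤ (n ℕ.+ 1)) λ v →
           InLattice R K γ v × IsNonzero v
           × normSq v ℤ.< + ((n ℕ.* n ℕ.+ n) ℕ.* (N ℕ.* N) ℕ.+ (2 ℕ.* n ℕ.+ 2) ℕ.* N ℕ.+ 2)
lemma1 R K _ N n γ _ (α , α≢0 , rel , α≤1+N , α-unique) =
  latticeVec R K γ α , (α , λ _ → refl) , ++-nonzeroˡ _ α≢0 , ‖v‖²<bound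
  where
  open RealField R using (_*_; ⌊_⌋; fromℤ)
  open RealFieldProperties R using (IsRelation; sumR≡sum; isRelation-scale; ∣∑-*-⌊⌋∣<∑∣∣)
  L = sumℤ (λ i → α i ℤ.* ⌊ fromℤ K * γ i ⌋)

  relKγ : IsRelation α (λ i → fromℤ K * γ i)
  relKγ = isRelation-scale (fromℤ K) α γ (trans (sym (sumR≡sum (λ i → fromℤ (α i) * γ i))) rel)

  ∣L∣<∑∣α∣ : ∣ L ∣ ℕ.< sumℕ (λ i → ∣ α i ∣)
  ∣L∣<∑∣α∣ = ∣∑-*-⌊⌋∣<∑∣∣ α α≢0 (λ i → fromℤ K * γ i) relKγ

  ‖v‖²<bound : normSq (latticeVec R K γ α)
               ℤ.< + ((n ℕ.* n ℕ.+ n) ℕ.* (N ℕ.* N) ℕ.+ (2 ℕ.* n ℕ.+ 2) ℕ.* N ℕ.+ 2)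
  ‖v‖²<bound = subst (ℤ._< _) (sym (normSq-++-const α L))
    (ℤ.+<+ (norm-bound n N _ _ ∣ L ∣
      (sumℕ-≤-weaklyBounded (λ x → x) (λ x≤y → x≤y) N _ α≤1+N α-unique)
      (sumℕ-≤-weaklyBounded (λ x → x ℕ.* x) (λ x≤y → ℕP.*-mono-≤ x≤y x≤y) N _ α≤1+N α-unique)
      ∣L∣<∑∣α∣))
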